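{- Let $N$ be a positive integer and $k\in\mathbb{Z}$, and put $M=N/\gcd(k,N)$. If $\mu(M)/\varphi(M)\in\{ -1,-1/2,-1/4\}$, then there exists $t\in\mathbb{Z}$ such that $k=tN/2$ or $k=tN/3$ or $k=tN/5$.
   Context: $\varphi$ denotes Euler's totient function and $\mu$ the Möbius function; $\gcd(0,N)=N$. -}

module Defs where

open import Data.Nat using (ℕ; zero; suc; _*_; _/_; NonZero; ≢-nonZero)
open import Data.Nat.GCD using (gcd; gcd[m,n]≢0)
open import Data.Nat.Divisibility using (_∣?_)
open import Data.Nat.Primality using (prime?)
open import Data.Nat.Properties using (_≟_)
open import Data.Integer as ℤ using (ℤ; ∣_∣)
open import Data.List using (List; []; _∷_; filter; length; drop; upTo; foldr; map)
open import Data.Sum using (inj₂)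
open import Data.Bool using (Bool; true; _∧_; if_then_else_)
open import Relation.Nullary.Decidable using (does; ¬?)
open import Relation.Nullary using (¬_)
open import Relation.Binary.PropositionalEquality using (_≢_)

range1 : ℕ → List ℕ
range1 n = map suc (upTo n)

φ : ℕ → ℕ
φ n = length (filter (λ i → gcd i n ≟ 1) (range1 n))

ω : ℕ → ℕ
ω n = length (filter (λ p → prime? p) (filter (λ p → p ∣? n) (range1 n)))

squarefree? : ℕ → Bool
squarefree? n = foldr _∧_ true (map (λ d → does (¬? ((d * d) ∣? n))) (drop 1 (range1 n)))

μ : ℕ → ℤ
μ n = if squarefree? n then (ℤ.-1ℤ ℤ.^ ω n) else ℤ.0ℤ

reducedModulus : (k : ℤ) (N : ℕ) → .{{NonZero N}} → ℕ
reducedModulus k (suc n) = _/_ (suc n) (gcd ∣ k ∣ (suc n))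
  {{≢-nonZero (gcd[m,n]≢0 ∣ k ∣ (suc n) (inj₂ (λ ())))}}

-- If μ(M)/φ(M) ∈ {-1, -1/2, -1/4} then μ(M) = -1 and φ(M) ≤ 4. Every M ≥ 13 is
-- either divisible by 4, so μ(M) = 0, or has at least five totatives: for odd M
-- take 1, 2, 4, M - 4, M - 2, for M = 2y with y odd take 1, y ∓ 4, y ∓ 2. Hence
-- M ≤ 12, and a finite check leaves M ∈ {2, 3, 5}. Finally M = N / gcd(k, N)
-- always satisfies k M ≡ 0 (mod N).
module Submission where

open import Defs
open import Data.Nat using (ℕ; NonZero)
open import Data.Integer using (ℤ; +_; -_; _*_)
open import Data.Product using (∃)
open import Data.Sum using (_⊎_)
open import Relation.Binary.PropositionalEquality using (_≡_)

open import Data.Nat as ℕ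
  using (zero; suc; _+_; _^_; _/_; _≤_; _<_; _≤′_; z≤n; s≤s; z<s; s<s; ≤′-refl; ≤′-step)
open import Data.Nat.Properties as ℕ
  using (≤-refl; ≤-trans; m≤m+n; m≤n+m; +-mono-≤; m≤m*n; +-comm; ≤⇒≤′; allUpTo?)
open import Data.Nat.Divisibility
  using (_∣_; _∣?_; ∣-trans; ∣1⇒≡1; m∣m*n; n∣m*n; ∣m+n∣m⇒∣n; n∣m⇒m%n≡0)
open import Data.Nat.DivMod using ([m+kn]%n≡m%n; m*[n/m]≡n)
open import Data.Nat.GCD using (gcd; gcd-zeroˡ; gcd[m,n]∣m; gcd[m,n]∣n; gcd[m,n]≢0)
open import Data.Nat.Coprimality using (Coprime; coprime⇒gcd≡1; coprime-divisor)
open import Data.Nat.Primality using (prime?; prime⇒irreducible)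
open import Data.Integer as ℤ using (-1ℤ; 0ℤ; ∣_∣)
open import Data.Integer.Properties using (*-assoc; pos-*; neg-injective; +-injective; -1*i≡-i)
import Data.Integer.Divisibility.Signed as ℤ∣
open import Data.List using ([]; _∷_; [_]; _++_; filter; length; upTo; map)
open import Data.List.Properties using (upTo-∷ʳ; map-++; filter-++; filter-accept; length-++)
open import Data.List.Relation.Unary.All using (All; []; _∷_)
open import Data.List.Relation.Unary.Linked using (Linked; [-]; _∷_)
open import Data.Product using (_,_; _×_; proj₁; proj₂)
open import Data.Sum as Sum using (inj₁; inj₂; [_,_]′)
open import Data.Bool using (true; false)
open import Function using (_∘_)
open import Relation.Nullary using (¬_; Dec; contradiction)
open import Relation.Nullary.Decidable
  using (_⊎-dec_; _→-dec_; dec-true; from-yes; toWitness)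
open import Relation.Unary using (Pred; Decidable)
open import Relation.Binary.PropositionalEquality
  using (refl; sym; trans; cong; subst; module ≡-Reasoning)

range1-suc : ∀ n → range1 (suc n) ≡ range1 n ++ [ suc n ]
range1-suc n = trans (cong (map suc) (sym (upTo-∷ʳ n))) (map-++ suc (upTo n) [ n ])

module Counting {p} {P : Pred ℕ p} (P? : Decidable P) where

  count : ℕ → ℕ
  count n = length (filter P? (range1 n))

  count-suc : ∀ n → count (suc n) ≡ count n + length (filter P? [ suc n ])
  count-suc n = begin
    length (filter P? (range1 (suc n)))
      ≡⟨ cong (length ∘ filter P?) (range1-suc n) ⟩
    length (filter P? (range1 n ++ [ suc n ]))
      ≡⟨ cong length (filter-++ P? (range1 n) [ suc n ]) ⟩
    length (filter P? (range1 n) ++ filter P? [ suc n ])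
      ≡⟨ length-++ (filter P? (range1 n)) ⟩
    count n + length (filter P? [ suc n ]) ∎
    where open ≡-Reasoning

  count-accept : ∀ {n} → P (suc n) → count (suc n) ≡ suc (count n)
  count-accept {n} P[1+n] = begin
    count (suc n)                          ≡⟨ count-suc n ⟩
    count n + length (filter P? [ suc n ])
      ≡⟨ cong (λ xs → count n + length xs) (filter-accept P? P[1+n]) ⟩
    count n + 1                            ≡⟨ +-comm (count n) 1 ⟩
    suc (count n)                          ∎
    where open ≡-Reasoning

  count-mono : ∀ {m n} → m ≤ n → count m ≤ count n
  count-mono = mono′ ∘ ≤⇒≤′
    where
    mono′ : ∀ {m n} → m ≤′ n → count m ≤ count n
    mono′ ≤′-refl            = ≤-refl
    mono′ (≤′-step {n} m≤′n) =
      ≤-trans (mono′ m≤′n) (≤-trans (m≤m+n (count n) _) (ℕ.≤-reflexive (sym (count-suc n))))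

  count-< : ∀ {a b} → a < b → P b → count a < count b
  count-< {a} {suc b} (s≤s a≤b) P[b] rewrite count-accept P[b] = s≤s (count-mono a≤b)

  -- the sentinel suc n bounds the witnesses by n
  length≤count : ∀ {a n} xs → Linked _<_ (a ∷ xs ++ [ suc n ]) → All P xs →
                 count a + length xs ≤ count n
  length≤count {a} [] (s≤s a≤n ∷ [-]) [] rewrite ℕ.+-identityʳ (count a) = count-mono a≤n
  length≤count {a} (x ∷ xs) (a<x ∷ chain) (P[x] ∷ Ps) = begin
    count a + suc (length xs) ≡⟨ ℕ.+-suc (count a) (length xs) ⟩
    suc (count a) + length xs ≤⟨ +-mono-≤ (count-< a<x P[x]) ≤-refl ⟩
    count x + length xs       ≤⟨ length≤count xs chain Ps ⟩
    _                         ∎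
    where open ℕ.≤-Reasoning

φ≥length : ∀ M xs → Linked _<_ (0 ∷ xs ++ [ suc M ]) → All (λ x → gcd x M ≡ 1) xs →
           length xs ≤ φ M
φ≥length M = Counting.length≤count (λ i → gcd i M ℕ.≟ 1)

φ>0 : ∀ M → .{{NonZero M}} → 0 < φ M
φ>0 (suc M) = φ≥length (suc M) [ 1 ] (z<s ∷ s<s z<s ∷ [-]) (gcd-zeroˡ (suc M) ∷ [])

¬2∣1+q*2 : ∀ q → ¬ 2 ∣ 1 + q ℕ.* 2
¬2∣1+q*2 q 2∣1+q*2 with () ← trans (sym ([m+kn]%n≡m%n 1 q 2)) (n∣m⇒m%n≡0 _ 2 2∣1+q*2)

¬2∣⇒coprime-2 : ∀ {d} → ¬ 2 ∣ d → Coprime d 2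
¬2∣⇒coprime-2 2∤d (e∣d , e∣2) with prime⇒irreducible (from-yes (prime? 2)) e∣2
... | inj₁ e≡1 = e≡1
... | inj₂ refl with () ← 2∤d e∣d

¬2∣∧∣2^k⇒≡1 : ∀ {d} k → ¬ 2 ∣ d → d ∣ 2 ^ k → d ≡ 1
¬2∣∧∣2^k⇒≡1 zero    2∤d d∣1 = ∣1⇒≡1 d∣1
¬2∣∧∣2^k⇒≡1 (suc k) 2∤d d∣2*2^k =
  ¬2∣∧∣2^k⇒≡1 k 2∤d (coprime-divisor (¬2∣⇒coprime-2 2∤d) d∣2*2^k)

∣m+n∣n⇒∣m : ∀ {d m n} → d ∣ m + n → d ∣ n → d ∣ m
∣m+n∣n⇒∣m {d} {m} {n} d∣m+n = ∣m+n∣m⇒∣n (subst (d ∣_) (+-comm m n) d∣m+n)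

¬2∣∧∣⇒¬2∣ : ∀ {d n} → ¬ 2 ∣ n → d ∣ n → ¬ 2 ∣ d
¬2∣∧∣⇒¬2∣ 2∤n d∣n 2∣d = 2∤n (∣-trans 2∣d d∣n)

gcd≡1-via-2^k : ∀ {x M} k → (¬ 2 ∣ x) ⊎ (¬ 2 ∣ M) → (∀ {d} → d ∣ x → d ∣ M → d ∣ 2 ^ k) →
                gcd x M ≡ 1
gcd≡1-via-2^k k x-or-M-odd common∣2^k = coprime⇒gcd≡1 λ (d∣x , d∣M) →
  ¬2∣∧∣2^k⇒≡1 k ([ (λ 2∤x → ¬2∣∧∣⇒¬2∣ 2∤x d∣x) , (λ 2∤M → ¬2∣∧∣⇒¬2∣ 2∤M d∣M) ]′ x-or-M-odd)
    (common∣2^k d∣x d∣M)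

-- In both lemmas each witness x satisfies M = 2ʲ + x, M = 2ʲ + 2x or 2x = 2ʲ + M
-- definitionally, which is why ∣m+n∣n⇒∣m applies without any rewriting.
φ[9+2r]≥5 : ∀ r → 5 ≤ φ (1 + (4 + r) ℕ.* 2)
φ[9+2r]≥5 r = φ≥length M (1 ∷ 2 ∷ 4 ∷ 5 + v ∷ 7 + v ∷ [])
  (z<s ∷ s<s z<s ∷ s≤s (m≤n+m 2 1) ∷ m≤m+n 5 v ∷ s≤s (m≤n+m (5 + v) 1) ∷
   s≤s (m≤n+m (7 + v) 2) ∷ [-])
  (gcd-zeroˡ M ∷ coprime 1 (λ d∣2 _ → d∣2) ∷ coprime 2 (λ d∣4 _ → d∣4) ∷
   coprime 2 (λ d∣x d∣M → ∣m+n∣n⇒∣m d∣M d∣x) ∷ coprime 1 (λ d∣x d∣M → ∣m+n∣n⇒∣m d∣M d∣x) ∷ [])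
  where
  v = r ℕ.* 2
  M = 1 + (4 + r) ℕ.* 2
  coprime : ∀ k {x} → (∀ {d} → d ∣ x → d ∣ M → d ∣ 2 ^ k) → gcd x M ≡ 1
  coprime k = gcd≡1-via-2^k k (inj₂ (¬2∣1+q*2 (4 + r)))

φ[14+4r]≥5 : ∀ r → 5 ≤ φ ((7 + r ℕ.* 2) ℕ.* 2)
φ[14+4r]≥5 r = φ≥length M (1 ∷ 3 + v ∷ 5 + v ∷ 9 + v ∷ 11 + v ∷ [])
  (z<s ∷ s≤s (s≤s z≤n) ∷ s≤s (m≤n+m (3 + v) 1) ∷ s≤s (m≤n+m (5 + v) 3) ∷ s≤s (m≤n+m (9 + v) 1) ∷
   s≤s (+-mono-≤ (m≤m+n 11 3) (m≤m*n v 2)) ∷ [-])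
  (gcd-zeroˡ M ∷
   coprime 1 3 (λ d∣x d∣M → ∣m+n∣n⇒∣m d∣M (2x d∣x)) ∷
   coprime 2 2 (λ d∣x d∣M → ∣m+n∣n⇒∣m d∣M (2x d∣x)) ∷
   coprime 4 2 (λ d∣x d∣M → ∣m+n∣n⇒∣m (2x d∣x) d∣M) ∷
   coprime 5 3 (λ d∣x d∣M → ∣m+n∣n⇒∣m (2x d∣x) d∣M) ∷ [])
  where
  v = r ℕ.* 2
  M = (7 + v) ℕ.* 2
  2x : ∀ {d x} → d ∣ x → d ∣ x ℕ.* 2
  2x d∣x = ∣-trans d∣x (m∣m*n 2)
  coprime : ∀ c k → (∀ {d} → d ∣ 1 + (c + r) ℕ.* 2 → d ∣ M → d ∣ 2 ^ k) →
            gcd (1 + (c + r) ℕ.* 2) M ≡ 1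
  coprime c k = gcd≡1-via-2^k k (inj₁ (¬2∣1+q*2 (c + r)))

-1ℤ^n≡±1 : ∀ n → -1ℤ ℤ.^ n ≡ ℤ.1ℤ ⊎ -1ℤ ℤ.^ n ≡ -1ℤ
-1ℤ^n≡±1 zero = inj₁ refl
-1ℤ^n≡±1 (suc n) with -1ℤ^n≡±1 n
... | inj₁ eq rewrite eq = inj₂ refl
... | inj₂ eq rewrite eq = inj₁ refl

μ≡0⊎±1 : ∀ M → μ M ≡ 0ℤ ⊎ μ M ≡ ℤ.1ℤ ⊎ μ M ≡ -1ℤ
μ≡0⊎±1 M with squarefree? M
... | false = inj₁ refl
... | true  = inj₂ (-1ℤ^n≡±1 (ω M))

-- 2 is the first candidate d tested by squarefree?, so 4 ∣ M decides it at once
4∣⇒μ≡0 : ∀ {n} → 4 ∣ 2 + n → μ (2 + n) ≡ 0ℤ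
4∣⇒μ≡0 {n} 4∣M rewrite dec-true (4 ∣? (2 + n)) 4∣M = refl

ExceptionalRatio : ℕ → Set
ExceptionalRatio M =
  μ M * + 1 ≡ - (+ φ M) ⊎ μ M * + 2 ≡ - (+ φ M) ⊎ μ M * + 4 ≡ - (+ φ M)

exceptionalRatio? : ∀ M → Dec (ExceptionalRatio M)
exceptionalRatio? M = (_ ℤ.≟ _) ⊎-dec (_ ℤ.≟ _) ⊎-dec (_ ℤ.≟ _)

0⊎±1*c≡-f : ∀ {m f} c → .{{NonZero c}} → m ≡ 0ℤ ⊎ m ≡ ℤ.1ℤ ⊎ m ≡ -1ℤ →
            m * + c ≡ - (+ f) → f ≡ 0 ⊎ (m ≡ -1ℤ × f ≡ c)
0⊎±1*c≡-f             c       (inj₁ refl)        eq = inj₁ (sym (+-injective (neg-injective eq)))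
0⊎±1*c≡-f {f = zero}  (suc c) (inj₂ (inj₁ refl)) ()
0⊎±1*c≡-f {f = suc f} (suc c) (inj₂ (inj₁ refl)) ()
0⊎±1*c≡-f             c       (inj₂ (inj₂ refl)) eq =
  inj₂ (refl , sym (+-injective (neg-injective (trans (sym (-1*i≡-i (+ c))) eq))))

exceptionalRatio⇒μ≡-1×φ≤4 : ∀ M → .{{NonZero M}} → ExceptionalRatio M →
                            μ M ≡ -1ℤ × φ M ≤ 4
exceptionalRatio⇒μ≡-1×φ≤4 M =
  [ case 1 (s≤s z≤n) , [ case 2 (s≤s (s≤s z≤n)) , case 4 ≤-refl ]′ ]′
  where
  case : ∀ c .{{_ : NonZero c}} → c ≤ 4 → μ M * + c ≡ - (+ φ M) → μ M ≡ -1ℤ × φ M ≤ 4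
  case c c≤4 eq = [ (λ φ≡0 → contradiction φ≡0 (ℕ.>⇒≢ (φ>0 M)))
                   , (λ (μ≡-1 , φ≡c) → μ≡-1 , subst (_≤ 4) (sym φ≡c) c≤4)
                   ]′ (0⊎±1*c≡-f c (μ≡0⊎±1 M) eq)

-- the indices are chosen so that adding 4 to any of them is definitionally another index
data LargeModulus : ℕ → Set where
  odd           : ∀ r → LargeModulus (1 + (4 + r) ℕ.* 2)
  twice-odd     : ∀ r → LargeModulus ((7 + r ℕ.* 2) ℕ.* 2)
  multiple-of-4 : ∀ r → LargeModulus ((4 + r) ℕ.* 4)

largeModulus-+4 : ∀ {M} → LargeModulus M → LargeModulus (4 + M)
largeModulus-+4 (odd r)           = odd (2 + r)
largeModulus-+4 (twice-odd r)     = twice-odd (1 + r)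
largeModulus-+4 (multiple-of-4 r) = multiple-of-4 (1 + r)

largeModulus : ∀ n → LargeModulus (13 + n)
largeModulus 0 = odd 2
largeModulus 1 = twice-odd 0
largeModulus 2 = odd 3
largeModulus 3 = multiple-of-4 0
largeModulus (suc (suc (suc (suc n)))) = largeModulus-+4 (largeModulus n)

largeModulus⇒¬exceptionalRatio : ∀ {M} → LargeModulus M → ¬ ExceptionalRatio M
largeModulus⇒¬exceptionalRatio {M} (odd r) ratio =
  ℕ.≤⇒≯ (proj₂ (exceptionalRatio⇒μ≡-1×φ≤4 M ratio)) (φ[9+2r]≥5 r)
largeModulus⇒¬exceptionalRatio {M} (twice-odd r) ratio =
  ℕ.≤⇒≯ (proj₂ (exceptionalRatio⇒μ≡-1×φ≤4 M ratio)) (φ[14+4r]≥5 r)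
largeModulus⇒¬exceptionalRatio {M} (multiple-of-4 r) ratio =
  contradiction (trans (sym (4∣⇒μ≡0 (n∣m*n (4 + r)))) (proj₁ (exceptionalRatio⇒μ≡-1×φ≤4 M ratio)))
                λ ()

≥13⇒largeModulus : ∀ {M} → 13 ≤ M → LargeModulus M
≥13⇒largeModulus 13≤M = let n , 13+n≡M = ℕ.m≤n⇒∃[o]m+o≡n 13≤M in
  subst LargeModulus 13+n≡M (largeModulus n)

exceptionalRatio<13⇒M∈2,3,5 : ∀ {M} → M < 13 → ExceptionalRatio M → M ≡ 2 ⊎ M ≡ 3 ⊎ M ≡ 5
exceptionalRatio<13⇒M∈2,3,5 = toWitness {a? = allUpTo? (λ M → exceptionalRatio? M →-dec
  ((M ℕ.≟ 2) ⊎-dec (M ℕ.≟ 3) ⊎-dec (M ℕ.≟ 5))) 13} _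

exceptionalRatio⇒M∈2,3,5 : ∀ M → ExceptionalRatio M → M ≡ 2 ⊎ M ≡ 3 ⊎ M ≡ 5
exceptionalRatio⇒M∈2,3,5 M ratio =
  [ (λ M<13 → exceptionalRatio<13⇒M∈2,3,5 M<13 ratio)
  , (λ 13≤M → contradiction ratio (largeModulus⇒¬exceptionalRatio (≥13⇒largeModulus 13≤M)))
  ]′ (ℕ.<-≤-connex M 13)

reducedModulus-annihilates : ∀ N .{{_ : NonZero N}} k →
                             ∃ λ t → k * + reducedModulus k N ≡ t * + N
reducedModulus-annihilates N@(suc _) k = q , (begin
    k * + (N / g)         ≡⟨ cong (_* + (N / g)) k≡q*g ⟩
    q * + g * + (N / g)   ≡⟨ *-assoc q (+ g) (+ (N / g)) ⟩
    q * (+ g * + (N / g)) ≡⟨ cong (q *_) (sym (pos-* g (N / g))) ⟩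
    q * + (g ℕ.* (N / g)) ≡⟨ cong (λ m → q * + m) (m*[n/m]≡n (gcd[m,n]∣n ∣ k ∣ N)) ⟩
    q * + N               ∎)
  where
  open ≡-Reasoning
  g = gcd ∣ k ∣ N
  open ℤ∣._∣_ (ℤ∣.∣ᵤ⇒∣ {+ g} {k} (gcd[m,n]∣m ∣ k ∣ N))
    renaming (quotient to q; equality to k≡q*g)
  instance
    _ : NonZero g
    _ = ℕ.≢-nonZero (gcd[m,n]≢0 ∣ k ∣ N (inj₂ (ℕ.≢-nonZero⁻¹ N)))

mainTheorem2 : (N : ℕ) → .{{_ : NonZero N}} → (k : ℤ) →
    (μ (reducedModulus k N) * + 1 ≡ - (+ φ (reducedModulus k N))
      ⊎ μ (reducedModulus k N) * + 2 ≡ - (+ φ (reducedModulus k N))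
      ⊎ μ (reducedModulus k N) * + 4 ≡ - (+ φ (reducedModulus k N))) →
    ∃ λ (t : ℤ) → (k * + 2 ≡ t * + N) ⊎ (k * + 3 ≡ t * + N) ⊎ (k * + 5 ≡ t * + N)
mainTheorem2 N k ratio with t , kM≡tN ← reducedModulus-annihilates N k =
  t , Sum.map annihilates (Sum.map annihilates annihilates)
          (exceptionalRatio⇒M∈2,3,5 (reducedModulus k N) ratio)
  where
  annihilates : ∀ {c} → reducedModulus k N ≡ c → k * + c ≡ t * + N
  annihilates refl = kM≡tN
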